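{- The sparse-DAG procedure LCBS\_SparseDAG$(A,B)$ described in the context outputs the length of a longest common bitonic subsequence of $A$ and $B$.
   Context: $A[0..n-1]$, $B[0..m-1]$ are sequences over a totally ordered alphabet. A common bitonic subsequence is given by index pairs $(i_1,j_1),\dots,(i_\ell,j_\ell)$ with $i_1<\dots<i_\ell$, $j_1<\dots<j_\ell$, $A[i_k]=B[j_k]$, and some $h$ with $A[i_1]<\dots<A[i_h]$ and $A[i_h]>\dots>A[i_\ell]$; the LCBS length is the maximum such $\ell$. Procedure: list all matches $(i,j)$ with $A[i]=B[j]$ in MATCHES, sorted by $(i\uparrow,j\uparrow)$. For $v=(i,j)$: $r_J(v)$ is one plus the rank of $j$ among sorted distinct $j$-values in MATCHES; $r_V(v)$ is the 1-based rank of $A[i]$ among sorted distinct values of $A\cup B$; $MAX_J=\max r_J$, $\widehat r_J(v)=MAX_J-r_J(v)+1$. A 2-D range tree supports Update(point $(x,y)$, value) and Query$(x,y)$ returning the maximum value stored at points $(x',y')$ with $x'\le x$, $y'\le y$ (0 if none). Forward pass: with empty tree $RT_{inc}$, for each $v$ in MATCHES order: $INC[v]\gets$ Query$(RT_{inc},r_J(v)-1,r_V(v)-1)+1$; Update$(RT_{inc},(r_J(v),r_V(v)),INC[v])$. Backward pass: with empty tree $RT_{dec}$, for each $v$ in reverse MATCHES order: $DEC[v]\gets$ Query$(RT_{dec},\widehat r_J(v)-1,r_V(v)-1)+1$; Update$(RT_{dec},(\widehat r_J(v),r_V(v)),DEC[v])$. Output $bestLen=\max(0,\max_{v}(INC[v]+DEC[v]-1))$.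 -}

module Defs where

open import Level using (Level)
open import Data.Nat using (ℕ; zero; suc; _+_; _∸_; _⊔_; _≤_; _≤?_)
import Data.Nat as ℕ
open import Data.Fin using (Fin; toℕ)
open import Data.List using (List; []; _∷_; _++_; [_]; map; filter; deduplicate; concatMap; foldr; length; reverse; zipWith; allFin)
open import Data.List.Relation.Unary.All using (All)
open import Data.List.Relation.Unary.Linked using (Linked)
open import Data.Product using (_×_; _,_; proj₁; proj₂; Σ; ∃; ∃-syntax)
open import Data.Sum using (_⊎_)
open import Relation.Binary.Bundles using (StrictTotalOrder)
open import Relation.Binary.PropositionalEquality using (_≡_)
open import Relation.Nullary.Decidable using (_×-dec_)
open import Function using (_∘_; flip)

module LCBS {a ℓ₁ ℓ₂ : Level} (O : StrictTotalOrder a ℓ₁ ℓ₂) where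
  open StrictTotalOrder O renaming (Carrier to C)

  Bitonic : List C → Set (a Level.⊔ ℓ₂)
  Bitonic xs = (xs ≡ []) ⊎
    (Σ (List C) λ pre → Σ C λ x → Σ (List C) λ post →
       (xs ≡ pre ++ x ∷ post) × Linked _<_ (pre ++ [ x ]) × Linked (flip _<_) (x ∷ post))

  module _ {n m : ℕ} (A : Fin n → C) (B : Fin m → C) where

    StrictPair : Fin n × Fin m → Fin n × Fin m → Set
    StrictPair (i , j) (i' , j') = (toℕ i ℕ.< toℕ i') × (toℕ j ℕ.< toℕ j')

    IsCBS : List (Fin n × Fin m) → Set (a Level.⊔ ℓ₁ Level.⊔ ℓ₂)
    IsCBS ps = Linked StrictPair ps
             × All (λ p → A (proj₁ p) ≈ B (proj₂ p)) ps
             × Bitonic (map (A ∘ proj₁) ps)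

    IsLCBSLength : ℕ → Set (a Level.⊔ ℓ₁ Level.⊔ ℓ₂)
    IsLCBSLength L = (Σ (List (Fin n × Fin m)) λ ps → IsCBS ps × length ps ≡ L)
                   × (∀ ps → IsCBS ps → length ps ≤ L)

    Match : Set
    Match = Fin n × Fin m

    -- all matches, sorted by (i ↑, j ↑)
    matches : List Match
    matches = concatMap (λ i → map (i ,_) (filter (λ j → A i ≟ B j) (allFin m))) (allFin n)

    maxList : List ℕ → ℕ
    maxList = foldr _⊔_ 0

    distinctJ : List ℕ
    distinctJ = deduplicate ℕ._≟_ (map (toℕ ∘ proj₂) matches)

    rJ : Match → ℕ
    rJ (i , j) = 1 + (1 + length (filter (ℕ._<? toℕ j) distinctJ))

    distinctV : List C
    distinctV = deduplicate _≟_ (map A (allFin n) ++ map B (allFin m))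

    rV : Match → ℕ
    rV (i , j) = 1 + length (filter (_<? A i) distinctV)

    MAXJ : ℕ
    MAXJ = maxList (map rJ matches)

    rJhat : Match → ℕ
    rJhat v = MAXJ ∸ rJ v + 1

    -- 2-D range tree, modelled by its specification: the set of stored
    -- (point, value) entries; Query returns the max value over dominated points.
    RangeTree : Set
    RangeTree = List ((ℕ × ℕ) × ℕ)

    emptyRT : RangeTree
    emptyRT = []

    update : RangeTree → ℕ × ℕ → ℕ → RangeTree
    update t p val = (p , val) ∷ t

    query : RangeTree → ℕ → ℕ → ℕ
    query t x y = maxList (map proj₂ (filter (λ e → (proj₁ (proj₁ e) ≤? x) ×-dec (proj₂ (proj₁ e) ≤? y)) t))

    pass : (Match → ℕ × ℕ) → RangeTree → List Match → List ℕ
    pass key t [] = []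
    pass key t (v ∷ vs) =
      let x = proj₁ (key v) ; y = proj₂ (key v)
          d = query t (x ∸ 1) (y ∸ 1) + 1
      in d ∷ pass key (update t (x , y) d) vs

    INC : List ℕ
    INC = pass (λ v → rJ v , rV v) emptyRT matches

    DEC : List ℕ
    DEC = reverse (pass (λ v → rJhat v , rV v) emptyRT (reverse matches))

    lcbsSparseDAG : ℕ
    lcbsSparseDAG = 0 ⊔ maxList (zipWith (λ inc dec → inc + dec ∸ 1) INC DEC)

-- INC[v] is the length of a longest common strictly increasing subsequence ending at
-- the match v, and DEC[v] that of a longest common strictly decreasing one starting
-- at v. In the forward pass the matches are processed in (i, j)-lexicographic order,
-- and the ranks r_J, r_V reflect the order of columns and of values; so the matches
-- already stored in the range tree whose two ranks are both smaller are exactly the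
-- possible predecessors of v (one in the same row would have the same value), and by
-- induction the query returns the longest chain among them. The backward pass is the
-- mirror image, with the column ranks reversed. A common bitonic subsequence splits
-- at its peak into an increasing chain ending there and a decreasing chain starting
-- there, and conversely two such chains glue, so max (INC[v] + DEC[v] - 1) is the
-- LCBS length (and 0, the empty subsequence, when there are no matches).

module Submission where

open import Defs
open import Level using (Level; _⊔_; 0ℓ)
open import Data.Nat as ℕ using (ℕ; zero; suc; _+_; _∸_; _≤_; z≤n; s≤s; pred)
open import Data.Nat.Properties
  using (≤-trans; m≤m⊔n; m≤n⊔m; m<n⇒m<1+n; m≤n⇒m≤1+n; <⇒≱; ≰⇒>; <⇒≤pred; m≤n+m; +-suc; +-comm; ⊔-sel;
         +-mono-≤; +-monoˡ-<; +-monoˡ-≤; ∸-monoˡ-≤; ∸-monoʳ-<; ∸-monoʳ-≤; <-isStrictTotalOrder)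
open import Data.Fin using (Fin; toℕ)
import Data.Fin as Fin
import Data.Fin.Properties as Fin
open import Data.List using (List; []; _∷_; _++_; [_]; map; filter; foldr; length; zipWith; reverse; allFin)
open import Data.List.Properties
  using (++-assoc; ∷ʳ-++; reverse-++; reverse-involutive; unfold-reverse; length-++; length-map; map-++; ∷-injective)
open import Data.List.Relation.Unary.Any using (Any; here; there)
import Data.List.Relation.Unary.Any as Any
import Data.List.Relation.Unary.Any.Properties as Any
open import Data.List.Relation.Unary.All using (All; []; _∷_)
import Data.List.Relation.Unary.All as All
import Data.List.Relation.Unary.All.Properties as All
open import Data.List.Relation.Unary.AllPairs using (AllPairs; []; _∷_)
import Data.List.Relation.Unary.AllPairs.Properties as AllPairs
open import Data.List.Relation.Unary.Linked using (Linked; []; [-]; _∷_)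
import Data.List.Relation.Unary.Linked as Linked
import Data.List.Relation.Unary.Linked.Properties as Linked
open import Data.List.Relation.Binary.Pointwise using (Pointwise; []; _∷_)
import Data.List.Relation.Binary.Pointwise as Pointwise
open import Data.List.Membership.Propositional using (_∈_)
open import Data.List.Membership.Propositional.Properties
  using (∈-++⁺ˡ; ∈-++⁺ʳ; ∈-++⁻; ∈-map⁺; ∈-map⁻; ∈-filter⁺; ∈-filter⁻; ∈-allFin; ∈-concat⁺′; ∈-concat⁻′;
         ∈-deduplicate⁺; foldr-selective)
import Data.List.Membership.Setoid.Properties as SetoidMembership
open import Data.Product using (_×_; _,_; proj₁; proj₂; ∃-syntax; ∃₂)
open import Data.Product.Relation.Binary.Lex.Strict using (×-Lex; ×-irreflexive; ×-asymmetric)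
open import Data.Sum using (_⊎_; inj₁; inj₂)
open import Relation.Binary.PropositionalEquality using (_≡_; refl; cong; cong₂; subst; module ≡-Reasoning)
import Relation.Binary.PropositionalEquality as ≡
open import Relation.Binary using (Rel; REL; Irreflexive; Asymmetric; IsStrictTotalOrder; StrictTotalOrder; tri<; tri≈; tri>)
import Relation.Binary as Binary
open import Relation.Nullary using (yes; no; ¬_; Dec)
open import Relation.Nullary.Decidable using (_×-dec_)
open import Relation.Nullary.Negation using (contradiction)
open import Relation.Unary using (Pred; Decidable; _⊆_; _∩_; ∁)
open import Function using (_∘_; flip)

private
  variable
    x ℓ p q : Level
    X Y : Set x

≤-foldr-⊔ : ∀ {n ns} → n ∈ ns → n ≤ foldr ℕ._⊔_ 0 ns
≤-foldr-⊔ {n} {_ ∷ ns} (here refl) = m≤m⊔n n (foldr ℕ._⊔_ 0 ns)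
≤-foldr-⊔ {n} {k ∷ ns} (there n∈ns) = ≤-trans (≤-foldr-⊔ n∈ns) (m≤n⊔m k _)

≤pred⇒< : ∀ {m n} → 0 ℕ.< m → m ≤ pred n → m ℕ.< n
≤pred⇒< {n = suc n} _   m≤n = s≤s m≤n
≤pred⇒< {n = zero}  0<m m≤0 = contradiction m≤0 (<⇒≱ 0<m)

module _ {P : Pred X p} {Q : Pred X q} (P? : Decidable P) (Q? : Decidable Q) (P⊆Q : P ⊆ Q) where

  length-filter-⊆ : ∀ xs → length (filter P? xs) ≤ length (filter Q? xs)
  length-filter-⊆ [] = z≤n
  length-filter-⊆ (y ∷ xs) with P? y | Q? y
  ... | yes _  | yes _  = s≤s (length-filter-⊆ xs)
  ... | yes py | no ¬qy = contradiction (P⊆Q py) ¬qy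
  ... | no _   | yes _  = m≤n⇒m≤1+n (length-filter-⊆ xs)
  ... | no _   | no _   = length-filter-⊆ xs

  length-filter-⊂ : ∀ {xs} → Any (Q ∩ ∁ P) xs → length (filter P? xs) ℕ.< length (filter Q? xs)
  length-filter-⊂ {y ∷ xs} (here (qy , ¬py)) with P? y | Q? y
  ... | yes py | _      = contradiction py ¬py
  ... | no _   | yes _  = s≤s (length-filter-⊆ xs)
  ... | no _   | no ¬qy = contradiction qy ¬qy
  length-filter-⊂ {y ∷ xs} (there any) with P? y | Q? y
  ... | yes _  | yes _  = s≤s (length-filter-⊂ any)
  ... | yes py | no ¬qy = contradiction (P⊆Q py) ¬qy
  ... | no _   | yes _  = m<n⇒m<1+n (length-filter-⊂ any)
  ... | no _   | no _   = length-filter-⊂ any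

module Rank {_≈_ : Rel X ℓ} {_<_ : Rel X p} (sto : IsStrictTotalOrder _≈_ _<_)
            (_<?_ : Binary.Decidable _<_) where
  open IsStrictTotalOrder sto hiding (_<?_)

  rank : List X → X → ℕ
  rank xs y = length (filter (_<? y) xs)

  rank-strictMono : ∀ {xs y z} → Any (y ≈_) xs → y < z → rank xs y ℕ.< rank xs z
  rank-strictMono y∈xs y<z = length-filter-⊂ (_<? _) (_<? _) (λ u<y → trans u<y y<z)
    (Any.map (λ y≈u → <-respˡ-≈ y≈u y<z , irrefl (Eq.sym y≈u)) y∈xs)

  rank-reflects-< : ∀ {xs y z} → rank xs y ℕ.< rank xs z → y < z
  rank-reflects-< {xs} {y} {z} r< with compare y z
  ... | tri< y<z _ _ = y<z
  ... | tri≈ _ y≈z _ = contradiction (length-filter-⊆ (_<? z) (_<? y) (<-respʳ-≈ (Eq.sym y≈z)) xs) (<⇒≱ r<)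
  ... | tri> _ _ z<y = contradiction (length-filter-⊆ (_<? z) (_<? y) (λ u<z → trans u<z z<y) xs) (<⇒≱ r<)

module _ {R : Rel X ℓ} where

  AllPairs-++-∷⁻ : ∀ xs {v ys} → AllPairs R (xs ++ v ∷ ys) → All (flip R v) xs × All (R v) ys
  AllPairs-++-∷⁻ []       (v<ys ∷ _)    = [] , v<ys
  AllPairs-++-∷⁻ (x ∷ xs) (x<rest ∷ ps) =
    let xs<v , v<ys = AllPairs-++-∷⁻ xs ps in
    All.lookup x<rest (∈-++⁺ʳ xs (here refl)) ∷ xs<v , v<ys

  module _ (irrefl : Irreflexive _≡_ R) (asym : Asymmetric R) where

    AllPairs-∈-prefix : ∀ xs {v ys w} → AllPairs R (xs ++ v ∷ ys) → w ∈ xs ++ v ∷ ys → R w v → w ∈ xs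
    AllPairs-∈-prefix xs sorted w∈ w<v with ∈-++⁻ xs w∈
    ... | inj₁ w∈xs          = w∈xs
    ... | inj₂ (here refl)   = contradiction w<v (irrefl refl)
    ... | inj₂ (there w∈ys)  = contradiction (All.lookup (proj₂ (AllPairs-++-∷⁻ xs sorted)) w∈ys) (asym w<v)

    AllPairs-∈-suffix : ∀ xs {v ys w} → AllPairs R (xs ++ v ∷ ys) → w ∈ xs ++ v ∷ ys → R v w → w ∈ ys
    AllPairs-∈-suffix xs sorted w∈ v<w with ∈-++⁻ xs w∈
    ... | inj₁ w∈xs          = contradiction (All.lookup (proj₁ (AllPairs-++-∷⁻ xs sorted)) w∈xs) (asym v<w)
    ... | inj₂ (here refl)   = contradiction v<w (irrefl refl)
    ... | inj₂ (there w∈ys)  = w∈ys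

  Linked-++-∷⁺ : ∀ xs {v ys} → Linked R (xs ++ [ v ]) → Linked R (v ∷ ys) → Linked R (xs ++ v ∷ ys)
  Linked-++-∷⁺ []           _          right = right
  Linked-++-∷⁺ (_ ∷ [])     (r ∷ _)    right = r ∷ right
  Linked-++-∷⁺ (_ ∷ y ∷ xs) (r ∷ left) right = r ∷ Linked-++-∷⁺ (y ∷ xs) left right

  Linked-++-∷⁻ : ∀ xs {v ys} → Linked R (xs ++ v ∷ ys) → Linked R (xs ++ [ v ]) × Linked R (v ∷ ys)
  Linked-++-∷⁻ []           linked       = [-] , linked
  Linked-++-∷⁻ (_ ∷ [])     (r ∷ linked) = r ∷ [-] , linked
  Linked-++-∷⁻ (_ ∷ y ∷ xs) (r ∷ linked) =
    let left , right = Linked-++-∷⁻ (y ∷ xs) linked in r ∷ left , right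

map-≡-++-∷ : ∀ (f : X → Y) xs {pre y post} → map f xs ≡ pre ++ y ∷ post →
  ∃[ xs₁ ] ∃[ x ] ∃[ xs₂ ] xs ≡ xs₁ ++ x ∷ xs₂ × map f xs₁ ≡ pre × f x ≡ y × map f xs₂ ≡ post
map-≡-++-∷ f (x ∷ xs) {[]}      refl = [] , x , xs , refl , refl , refl , refl
map-≡-++-∷ f (x ∷ xs) {_ ∷ pre} eq with ∷-injective eq
... | refl , eq′ with map-≡-++-∷ f xs eq′
...   | xs₁ , x′ , xs₂ , refl , refl , refl , refl = x ∷ xs₁ , x′ , xs₂ , refl , refl , refl , refl

reverse-≡-++-∷ : ∀ {zs : List X} xs {v ys} → reverse zs ≡ xs ++ v ∷ ys → zs ≡ reverse ys ++ v ∷ reverse xs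
reverse-≡-++-∷ {zs = zs} xs {v} {ys} eq = begin
  zs                                   ≡⟨ reverse-involutive zs ⟨
  reverse (reverse zs)                 ≡⟨ cong reverse eq ⟩
  reverse (xs ++ v ∷ ys)               ≡⟨ reverse-++ xs (v ∷ ys) ⟩
  reverse (v ∷ ys) ++ reverse xs       ≡⟨ cong (_++ reverse xs) (unfold-reverse v ys) ⟩
  (reverse ys ++ [ v ]) ++ reverse xs  ≡⟨ ++-assoc (reverse ys) [ v ] (reverse xs) ⟩
  reverse ys ++ v ∷ reverse xs         ∎
  where open ≡-Reasoning

-- Chains

infixl 5 _▷_

data Chain {X : Set x} (R : Rel X ℓ) : X → ℕ → Set (x ⊔ ℓ) where
  start : ∀ {v} → Chain R v 1
  _▷_   : ∀ {w k v} → Chain R w k → R w v → Chain R v (suc k)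

MaxChain : {X : Set x} → Rel X ℓ → X → ℕ → Set (x ⊔ ℓ)
MaxChain R v d = Chain R v d × (∀ {k} → Chain R v k → k ≤ d)

module _ {R : Rel X ℓ} {P : Pred X p} where

  Chain⇒Linked-∷ʳ : ∀ {v k} → Chain (λ w v → R w v × P w) v k →
                    ∃[ xs ] All P xs × Linked R (xs ++ [ v ]) × suc (length xs) ≡ k
  Chain⇒Linked-∷ʳ start = [] , [] , [-] , refl
  Chain⇒Linked-∷ʳ (_▷_ {w} {v = v} chain (r , pw)) =
    let xs , all , linked , len = Chain⇒Linked-∷ʳ chain in
    xs ++ [ w ] ,
    All.++⁺ all (pw ∷ []) ,
    subst (Linked R) (≡.sym (∷ʳ-++ xs w [ v ])) (Linked-++-∷⁺ xs linked (r ∷ [-])) ,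
    cong suc (≡.trans (length-++ xs) (≡.trans (+-comm (length xs) 1) len))

  Linked-∷ʳ⇒Chain : ∀ xs {v} → All P xs → Linked R (xs ++ [ v ]) →
                    Chain (λ w v → R w v × P w) v (suc (length xs))
  Linked-∷ʳ⇒Chain []       _         _      = start
  Linked-∷ʳ⇒Chain (x ∷ xs) all linked = subst (Chain _ _) (+-comm (length xs) 2) (extend xs start all linked)
    where
      extend : ∀ ys {u v k} → Chain (λ w v → R w v × P w) u k → All P (u ∷ ys) → Linked R (u ∷ ys ++ [ v ]) →
               Chain (λ w v → R w v × P w) v (length ys + suc k)
      extend []       chain (pu ∷ _)  (r ∷ _)      = chain ▷ (r , pu)
      extend (y ∷ ys) {k = k} chain (pu ∷ all) (r ∷ linked) =
        subst (Chain _ _) (+-suc (length ys) (suc k)) (extend ys (chain ▷ (r , pu)) all linked)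

  Chain⇒Linked-∷ : ∀ {v k} → Chain (λ w v → R v w × P w) v k →
                   ∃[ ys ] All P ys × Linked R (v ∷ ys) × suc (length ys) ≡ k
  Chain⇒Linked-∷ start = [] , [] , [-] , refl
  Chain⇒Linked-∷ (_▷_ {w} chain (r , pw)) =
    let ys , all , linked , len = Chain⇒Linked-∷ chain in
    w ∷ ys , pw ∷ all , r ∷ linked , cong suc len

  Linked-∷⇒Chain : ∀ {v} ys → All P ys → Linked R (v ∷ ys) →
                   Chain (λ w v → R v w × P w) v (suc (length ys))
  Linked-∷⇒Chain []       _          _            = start
  Linked-∷⇒Chain (y ∷ ys) (py ∷ all) (r ∷ linked) = Linked-∷⇒Chain ys all linked ▷ (r , py)

module _ {a b s : Level} {V : Set a} {Z : Set b} {S : REL V Z s} where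

  Pointwise-∈ˡ : ∀ {vs zs v} → Pointwise S vs zs → v ∈ vs → ∃[ z ] z ∈ zs × S v z
  Pointwise-∈ˡ (s ∷ _)  (here refl) = _ , here refl , s
  Pointwise-∈ˡ (_ ∷ ss) (there v∈) = let z , z∈ , s = Pointwise-∈ˡ ss v∈ in z , there z∈ , s

  Pointwise-∈ʳ : ∀ {vs zs z} → Pointwise S vs zs → z ∈ zs → ∃[ v ] v ∈ vs × S v z
  Pointwise-∈ʳ (s ∷ _)  (here refl) = _ , here refl , s
  Pointwise-∈ʳ (_ ∷ ss) (there z∈) = let v , v∈ , s = Pointwise-∈ʳ ss z∈ in v , there v∈ , s

zipWith-Pointwise : ∀ {a b c d r s} {V : Set a} {X : Set b} {Y : Set c} {Z : Set d}
  {P : REL V X r} {Q : REL V Y s} (f : X → Y → Z) {vs xs ys} →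
  Pointwise P vs xs → Pointwise Q vs ys →
  Pointwise (λ v z → ∃₂ λ x y → P v x × Q v y × z ≡ f x y) vs (zipWith f xs ys)
zipWith-Pointwise f []       []       = []
zipWith-Pointwise f (p ∷ ps) (q ∷ qs) = (_ , _ , p , q , refl) ∷ zipWith-Pointwise f ps qs

module Correctness {a ℓ₁ ℓ₂ : Level} (O : StrictTotalOrder a ℓ₁ ℓ₂) {n m : ℕ}
  (A : Fin n → StrictTotalOrder.Carrier O) (B : Fin m → StrictTotalOrder.Carrier O) where

  open StrictTotalOrder O renaming (Carrier to C)
  private module L = LCBS O

  Match : Set
  Match = L.Match A B

  StrictPair : Rel Match 0ℓ
  StrictPair = L.StrictPair A B

  matches : List Match
  matches = L.matches A B

  IsCBS : List Match → Set (a ⊔ ℓ₁ ⊔ ℓ₂)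
  IsCBS = L.IsCBS A B

  distinctJ : List ℕ
  distinctJ = L.distinctJ A B

  distinctV : List C
  distinctV = L.distinctV A B

  rJ rV rJhat : Match → ℕ
  rJ = L.rJ A B
  rV = L.rV A B
  rJhat = L.rJhat A B

  IsMatch : Match → Set ℓ₁
  IsMatch v = A (proj₁ v) ≈ B (proj₂ v)

  val : Match → C
  val = A ∘ proj₁

  row : Fin n → List Match
  row i = map (i ,_) (filter (λ j → A i ≟ B j) (allFin m))

  IsMatch⇒∈matches : ∀ {v} → IsMatch v → v ∈ matches
  IsMatch⇒∈matches {i , j} i~j =
    ∈-concat⁺′ (∈-map⁺ (i ,_) (∈-filter⁺ (λ j → A i ≟ B j) (∈-allFin j) i~j)) (∈-map⁺ row (∈-allFin i))

  ∈matches⇒IsMatch : ∀ {v} → v ∈ matches → IsMatch v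
  ∈matches⇒IsMatch v∈ with ∈-concat⁻′ (map row (allFin n)) v∈
  ... | _ , v∈row , row∈ with ∈-map⁻ row row∈
  ...   | i , _ , refl with ∈-map⁻ (i ,_) v∈row
  ...     | j , j∈ , refl = proj₂ (∈-filter⁻ (λ j → A i ≟ B j) {xs = allFin m} j∈)

  _<ₗₑₓ_ : Rel Match 0ℓ
  _<ₗₑₓ_ = ×-Lex _≡_ Fin._<_ Fin._<_

  <ₗₑₓ-irrefl : Irreflexive _≡_ _<ₗₑₓ_
  <ₗₑₓ-irrefl refl = ×-irreflexive {_≈₁_ = _≡_} {_≈₂_ = _≡_} Fin.<-irrefl Fin.<-irrefl (refl , refl)

  <ₗₑₓ-asym : Asymmetric _<ₗₑₓ_
  <ₗₑₓ-asym = ×-asymmetric {_≈₁_ = _≡_} {_<₁_ = Fin._<_} {_<₂_ = Fin._<_} ≡.sym Fin.<-resp₂-≡ Fin.<-asym Fin.<-asym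

  matches-sorted : AllPairs _<ₗₑₓ_ matches
  matches-sorted = AllPairs.concat⁺
    (All.map⁺ (All.universal (λ i → AllPairs.map⁺ (AllPairs.filter⁺ _ (AllPairs.tabulate⁺-< (λ j<j′ → inj₂ (refl , j<j′))))) _))
    (AllPairs.map⁺ (AllPairs.tabulate⁺-< row-<ₗₑₓ))
    where
      row-<ₗₑₓ : ∀ {i i′} → i Fin.< i′ → All (λ v → All (v <ₗₑₓ_) (row i′)) (row i)
      row-<ₗₑₓ i<i′ = All.map⁺ (All.universal (λ _ → All.map⁺ (All.universal (λ _ → inj₁ i<i′) _)) _)

  private
    module RankJ = Rank <-isStrictTotalOrder ℕ._<?_
    module RankV = Rank isStrictTotalOrder _<?_

  col : Match → ℕ
  col = toℕ ∘ proj₂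

  rJ-strictMono : ∀ {w v} → w ∈ matches → col w ℕ.< col v → rJ w ℕ.< rJ v
  rJ-strictMono w∈ cw<cv = s≤s (s≤s (RankJ.rank-strictMono (∈-deduplicate⁺ ℕ._≟_ (∈-map⁺ col w∈)) cw<cv))

  rJ-reflects-< : ∀ {w v} → rJ w ℕ.< rJ v → col w ℕ.< col v
  rJ-reflects-< (s≤s (s≤s r<)) = RankJ.rank-reflects-< {xs = distinctJ} r<

  val∈distinctV : ∀ w → Any (val w ≈_) distinctV
  val∈distinctV (i , _) =
    SetoidMembership.∈-deduplicate⁺ Eq.setoid _≟_ (λ y′≈y x≈y → Eq.trans x≈y (Eq.sym y′≈y))
      (Any.++⁺ˡ (Any.map⁺ (Any.map (Eq.reflexive ∘ cong A) (∈-allFin i))))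

  rV-strictMono : ∀ {w v} → val w < val v → rV w ℕ.< rV v
  rV-strictMono {w} w<v = s≤s (RankV.rank-strictMono (val∈distinctV w) w<v)

  rV-reflects-< : ∀ {w v} → rV w ℕ.< rV v → val w < val v
  rV-reflects-< (s≤s r<) = RankV.rank-reflects-< {xs = distinctV} r<

  -- w ∈ matches gives rJ w ≤ MAXJ, so MAXJ ∸ rJ w does not truncate.
  rJhat-strictAnti : ∀ {w v} → w ∈ matches → rJ v ℕ.< rJ w → rJhat w ℕ.< rJhat v
  rJhat-strictAnti w∈ rv<rw = +-monoˡ-< 1 (∸-monoʳ-< rv<rw (≤-foldr-⊔ (∈-map⁺ rJ w∈)))

  rJhat-reflects-< : ∀ {w v} → rJhat w ℕ.< rJhat v → rJ v ℕ.< rJ w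
  rJhat-reflects-< {w} {v} h< = ≰⇒> (λ rw≤rv → <⇒≱ h< (+-monoˡ-≤ 1 (∸-monoʳ-≤ (L.MAXJ A B) rw≤rv)))

  <ₗₑₓ⇒StrictPair : ∀ {w v} → w <ₗₑₓ v → col w ℕ.< col v → ¬ val w ≈ val v → StrictPair w v
  <ₗₑₓ⇒StrictPair (inj₁ row<) col< _ = row< , col<
  <ₗₑₓ⇒StrictPair (inj₂ (same , _)) _ val≉ = contradiction (Eq.reflexive (cong A same)) val≉

  -- Correctness of one range-tree pass

  -- The dominance test made by query; on positive keys it is strict dominance.
  Below : ℕ × ℕ → ℕ × ℕ → Set
  Below (x′ , y′) (x , y) = x′ ≤ pred x × y′ ≤ pred y

  module Pass {ℓ : Level} (R : Rel Match ℓ) (key : Match → ℕ × ℕ) (vs : List Match)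
    (R⇒Below : ∀ {xs v ys w} → vs ≡ xs ++ v ∷ ys → R w v → w ∈ xs × Below (key w) (key v))
    (Below⇒R : ∀ {xs v ys w} → vs ≡ xs ++ v ∷ ys → w ∈ xs → Below (key w) (key v) → R w v) where

    Sound Complete : L.RangeTree A B → List Match → Set ℓ
    Sound t xs = ∀ {p d} → (p , d) ∈ t → ∃[ w ] w ∈ xs × p ≡ key w × MaxChain R w d
    Complete t xs = ∀ {w} → w ∈ xs → ∃[ d ] (key w , d) ∈ t × MaxChain R w d

    query-MaxChain : ∀ {xs v ys t} → vs ≡ xs ++ v ∷ ys → Sound t xs → Complete t xs →
                     MaxChain R v (L.query A B t (pred (proj₁ (key v))) (pred (proj₂ (key v))) + 1)
    query-MaxChain {xs} {v} {ys} {t} split sound complete = attained (foldr-selective ⊔-sel 0 candidates) , bounded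
      where
        below? : (e : (ℕ × ℕ) × ℕ) → Dec (Below (proj₁ e) (key v))
        below? ((x , y) , _) = (x ℕ.≤? pred (proj₁ (key v))) ×-dec (y ℕ.≤? pred (proj₂ (key v)))

        candidates : List ℕ
        candidates = map proj₂ (filter below? t)

        attained : foldr ℕ._⊔_ 0 candidates ≡ 0 ⊎ foldr ℕ._⊔_ 0 candidates ∈ candidates →
                   Chain R v (foldr ℕ._⊔_ 0 candidates + 1)
        attained (inj₁ best≡0) = subst (λ d → Chain R v (d + 1)) (≡.sym best≡0) start
        attained (inj₂ best∈) with ∈-map⁻ proj₂ best∈
        ... | _ , e∈ , refl with ∈-filter⁻ below? {xs = t} e∈
        ...   | e∈t , below with sound e∈t
        ...     | w , w∈ , refl , chain , _ = subst (Chain R v) (+-comm 1 _) (chain ▷ Below⇒R split w∈ below)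

        bounded : ∀ {k} → Chain R v k → k ≤ foldr ℕ._⊔_ 0 candidates + 1
        bounded start = m≤n+m 1 _
        bounded (_▷_ {k = k} chain r) =
          let w∈ , below = R⇒Below split r
              d , e∈t , _ , longest = complete w∈
          in subst (suc k ≤_) (+-comm 1 _)
               (s≤s (≤-trans (longest chain) (≤-foldr-⊔ (∈-map⁺ proj₂ (∈-filter⁺ below? e∈t below)))))

    Sound-∷ : ∀ {t xs v d} → MaxChain R v d → Sound t xs → Sound ((key v , d) ∷ t) (xs ++ [ v ])
    Sound-∷ {xs = xs} max _     (here refl) = _ , ∈-++⁺ʳ xs (here refl) , refl , max
    Sound-∷ max sound (there e∈) = let w , w∈ , p≡ , maxw = sound e∈ in w , ∈-++⁺ˡ w∈ , p≡ , maxw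

    Complete-∷ : ∀ {t xs v d} → MaxChain R v d → Complete t xs → Complete ((key v , d) ∷ t) (xs ++ [ v ])
    Complete-∷ {xs = xs} max complete w∈ with ∈-++⁻ xs w∈
    ... | inj₁ w∈xs        = let d , e∈ , maxw = complete w∈xs in d , there e∈ , maxw
    ... | inj₂ (here refl) = _ , here refl , max

    pass-MaxChain-from : ∀ xs ys t → vs ≡ xs ++ ys → Sound t xs → Complete t xs →
                     Pointwise (MaxChain R) ys (L.pass A B key t ys)
    pass-MaxChain-from xs []       t _     _     _        = []
    pass-MaxChain-from xs (v ∷ ys) t split sound complete =
      max ∷ pass-MaxChain-from (xs ++ [ v ]) ys _ (≡.trans split (≡.sym (++-assoc xs [ v ] ys)))
                           (Sound-∷ max sound) (Complete-∷ max complete)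
      where max = query-MaxChain split sound complete

    pass-MaxChain : Pointwise (MaxChain R) vs (L.pass A B key [] vs)
    pass-MaxChain = pass-MaxChain-from [] vs [] refl (λ ()) (λ ())

  Ascending Descending : Rel Match ℓ₂
  Ascending w v = StrictPair w v × val w < val v
  Descending v w = StrictPair v w × val w < val v

  -- An IncStep-chain ending at v is a common increasing subsequence ending at v; a
  -- DecStep-chain ending at v (in backward processing order) is a common decreasing
  -- subsequence starting at v. The last element is not required to be a match.
  IncStep DecStep : Rel Match (ℓ₁ ⊔ ℓ₂)
  IncStep w v = Ascending w v × IsMatch w
  DecStep w v = Descending v w × IsMatch w

  module _ {xs v ys} (split : matches ≡ xs ++ v ∷ ys) where

    private
      sorted : AllPairs _<ₗₑₓ_ (xs ++ v ∷ ys)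
      sorted = subst (AllPairs _<ₗₑₓ_) split matches-sorted

      ∈-split : ∀ {w} → IsMatch w → w ∈ xs ++ v ∷ ys
      ∈-split = subst (_ ∈_) split ∘ IsMatch⇒∈matches

    ∈matches-at : v ∈ matches
    ∈matches-at = subst (v ∈_) (≡.sym split) (∈-++⁺ʳ xs (here refl))

    <ₗₑₓ⇒∈prefix : ∀ {w} → IsMatch w → w <ₗₑₓ v → w ∈ xs
    <ₗₑₓ⇒∈prefix = AllPairs-∈-prefix <ₗₑₓ-irrefl <ₗₑₓ-asym xs sorted ∘ ∈-split

    >ₗₑₓ⇒∈suffix : ∀ {w} → IsMatch w → v <ₗₑₓ w → w ∈ ys
    >ₗₑₓ⇒∈suffix = AllPairs-∈-suffix <ₗₑₓ-irrefl <ₗₑₓ-asym xs sorted ∘ ∈-split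

    ∈prefix⇒<ₗₑₓ : ∀ {w} → w ∈ xs → w <ₗₑₓ v
    ∈prefix⇒<ₗₑₓ = All.lookup (proj₁ (AllPairs-++-∷⁻ xs sorted))

    ∈suffix⇒>ₗₑₓ : ∀ {w} → w ∈ ys → v <ₗₑₓ w
    ∈suffix⇒>ₗₑₓ = All.lookup (proj₂ (AllPairs-++-∷⁻ xs sorted))

  keyᶠ keyᵇ : Match → ℕ × ℕ
  keyᶠ v = rJ v , rV v
  keyᵇ v = rJhat v , rV v

  IncStep⇒Below : ∀ {xs v ys w} → matches ≡ xs ++ v ∷ ys → IncStep w v → w ∈ xs × Below (keyᶠ w) (keyᶠ v)
  IncStep⇒Below {v = v} {w = w} split ((pair , w<v) , w~) =
    <ₗₑₓ⇒∈prefix split w~ (inj₁ (proj₁ pair)) ,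
    <⇒≤pred (rJ-strictMono {w} {v} (IsMatch⇒∈matches w~) (proj₂ pair)) , <⇒≤pred (rV-strictMono {w} {v} w<v)

  Below⇒IncStep : ∀ {xs v ys w} → matches ≡ xs ++ v ∷ ys → w ∈ xs → Below (keyᶠ w) (keyᶠ v) → IncStep w v
  Below⇒IncStep {v = v} {w = w} split w∈xs (rJ≤ , rV≤) =
    (<ₗₑₓ⇒StrictPair (∈prefix⇒<ₗₑₓ split w∈xs) (rJ-reflects-< {w} {v} (≤pred⇒< (s≤s z≤n) rJ≤)) (flip irrefl w<v) , w<v) ,
    ∈matches⇒IsMatch (subst (_ ∈_) (≡.sym split) (∈-++⁺ˡ w∈xs))
    where w<v = rV-reflects-< {w} {v} (≤pred⇒< (s≤s z≤n) rV≤)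

  DecStep⇒Below : ∀ {xs v ys w} → reverse matches ≡ xs ++ v ∷ ys → DecStep w v → w ∈ xs × Below (keyᵇ w) (keyᵇ v)
  DecStep⇒Below {xs} {v} {w = w} rsplit ((pair , w<v) , w~) =
    Any.reverse⁻ (>ₗₑₓ⇒∈suffix split w~ (inj₁ (proj₁ pair))) ,
    <⇒≤pred (rJhat-strictAnti {w} {v} (IsMatch⇒∈matches w~) (rJ-strictMono {v} {w} (∈matches-at split) (proj₂ pair))) ,
    <⇒≤pred (rV-strictMono {w} {v} w<v)
    where split = reverse-≡-++-∷ xs rsplit

  Below⇒DecStep : ∀ {xs v ys w} → reverse matches ≡ xs ++ v ∷ ys → w ∈ xs → Below (keyᵇ w) (keyᵇ v) → DecStep w v
  Below⇒DecStep {xs} {v} {ys} {w} rsplit w∈xs (rJhat≤ , rV≤) =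
    (<ₗₑₓ⇒StrictPair (∈suffix⇒>ₗₑₓ split (Any.reverse⁺ w∈xs))
       (rJ-reflects-< {v} {w} (rJhat-reflects-< {w} {v} (≤pred⇒< (m≤n+m 1 _) rJhat≤))) (λ v≈w → irrefl (Eq.sym v≈w) w<v) , w<v) ,
    ∈matches⇒IsMatch (subst (_ ∈_) (≡.sym split) (∈-++⁺ʳ (reverse ys) (there (Any.reverse⁺ w∈xs))))
    where split = reverse-≡-++-∷ xs rsplit
          w<v = rV-reflects-< {w} {v} (≤pred⇒< (s≤s z≤n) rV≤)

  INC-MaxChain : Pointwise (MaxChain IncStep) matches (L.INC A B)
  INC-MaxChain = Pass.pass-MaxChain IncStep keyᶠ matches IncStep⇒Below Below⇒IncStep

  DEC-MaxChain : Pointwise (MaxChain DecStep) matches (L.DEC A B)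
  DEC-MaxChain = subst (λ vs → Pointwise (MaxChain DecStep) vs (L.DEC A B)) (reverse-involutive matches)
    (Pointwise.reverse⁺ (Pass.pass-MaxChain DecStep keyᵇ (reverse matches) DecStep⇒Below Below⇒DecStep))

  -- Peaks of common bitonic subsequences

  chains⇒CBS : ∀ {v i d} → IsMatch v → Chain IncStep v i → Chain DecStep v d →
               ∃[ ps ] IsCBS ps × length ps ≡ i + d ∸ 1
  chains⇒CBS {v} v~ inc dec =
    let pre , ms₁ , up , i≡ = Chain⇒Linked-∷ʳ inc
        post , ms₂ , down , d≡ = Chain⇒Linked-∷ dec
        pairs₁ , vals₁ = Linked.unzip up
        pairs₂ , vals₂ = Linked.unzip down
    in pre ++ v ∷ post ,
       (Linked-++-∷⁺ pre pairs₁ pairs₂ ,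
        All.++⁺ ms₁ (v~ ∷ ms₂) ,
        inj₂ (map val pre , val v , map val post , map-++ val pre (v ∷ post) ,
              subst (Linked _<_) (map-++ val pre [ v ]) (Linked.map⁺ vals₁) , Linked.map⁺ vals₂)) ,
       ≡.trans (length-++ pre) (cong₂ (λ i d → i + d ∸ 1) i≡ d≡)

  CBS⇒chains : ∀ {ps} → IsCBS ps → length ps ≡ 0 ⊎
               ∃[ v ] IsMatch v × ∃₂ λ i d → Chain IncStep v i × Chain DecStep v d × length ps ≡ i + d ∸ 1
  CBS⇒chains {ps} (_ , _ , inj₁ vals≡[]) = inj₁ (≡.trans (≡.sym (length-map val ps)) (cong length vals≡[]))
  CBS⇒chains {ps} (pairs , ms , inj₂ (_ , _ , _ , vals≡ , up , down)) with map-≡-++-∷ val ps vals≡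
  ... | ps₁ , p , ps₂ , refl , refl , refl , refl with Linked-++-∷⁻ ps₁ pairs | All.++⁻ ps₁ ms
  ...   | pairs₁ , pairs₂ | ms₁ , p~ ∷ ms₂ =
    inj₂ (p , p~ , _ , _ ,
          Linked-∷ʳ⇒Chain ps₁ ms₁ (Linked.zip (pairs₁ , Linked.map⁻ (subst (Linked _<_) (≡.sym (map-++ val ps₁ [ p ])) up))) ,
          Linked-∷⇒Chain ps₂ ms₂ (Linked.zip (pairs₂ , Linked.map⁻ down)) ,
          length-++ ps₁)

  Scored : Match → ℕ → Set (ℓ₁ ⊔ ℓ₂)
  Scored v z = ∃₂ λ i d → MaxChain IncStep v i × MaxChain DecStep v d × z ≡ i + d ∸ 1

  scores : List ℕ
  scores = zipWith (λ i d → i + d ∸ 1) (L.INC A B) (L.DEC A B)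

  scores-Scored : Pointwise Scored matches scores
  scores-Scored = zipWith-Pointwise _ INC-MaxChain DEC-MaxChain

  lcbs-attained : ∃[ ps ] IsCBS ps × length ps ≡ foldr ℕ._⊔_ 0 scores
  lcbs-attained with foldr-selective ⊔-sel 0 scores
  ... | inj₁ best≡0 = [] , ([] , [] , inj₁ refl) , ≡.sym best≡0
  ... | inj₂ best∈ with Pointwise-∈ʳ scores-Scored best∈
  ...   | v , v∈ , _ , _ , (inc , _) , (dec , _) , best≡ =
    let ps , cbs , len = chains⇒CBS (∈matches⇒IsMatch v∈) inc dec in ps , cbs , ≡.trans len (≡.sym best≡)

  lcbs-maximal : ∀ ps → IsCBS ps → length ps ≤ foldr ℕ._⊔_ 0 scores
  lcbs-maximal ps cbs with CBS⇒chains cbs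
  ... | inj₁ len≡0 = subst (_≤ _) (≡.sym len≡0) z≤n
  ... | inj₂ (v , v~ , _ , _ , inc , dec , len) with Pointwise-∈ˡ scores-Scored (IsMatch⇒∈matches v~)
  ...   | _ , z∈ , _ , _ , (_ , longestInc) , (_ , longestDec) , refl =
    subst (_≤ _) (≡.sym len) (≤-trans (∸-monoˡ-≤ 1 (+-mono-≤ (longestInc inc) (longestDec dec))) (≤-foldr-⊔ z∈))

mainTheorem10 : ∀ {a ℓ₁ ℓ₂ : Level} (O : StrictTotalOrder a ℓ₁ ℓ₂) {n m : ℕ}
    (A : Fin n → StrictTotalOrder.Carrier O) (B : Fin m → StrictTotalOrder.Carrier O) →
    LCBS.IsLCBSLength O A B (LCBS.lcbsSparseDAG O A B)
mainTheorem10 O A B = lcbs-attained , lcbs-maximal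
  where open Correctness O A B
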